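{- Let $w,k,b$ be positive integers with $k\le w$. If $B$ is a block of length $k$ with digits in $\{0,1,\dots,b\}$, then $$N(B,P_{b,w})\ge (w-k+1)\,(2^b-b)^{g_b(B)}\,2^{b(w-k)}.$$
   Context: For a positive integer $b$, define $\nu_b(j)=2^{ -b}$ for $0\le j\le b-1$, $\nu_b(b)=(2^b-b)/2^b$, $\nu_b(j)=0$ for $j>b$, and $\nu_b(c_1,\dots,c_k)=\prod_j\nu_b(c_j)$. Let $P_1,\dots,P_{(b+1)^w}$ be all blocks of length $w$ with digits in $\{0,\dots,b\}$, in lexicographic order, and let $P_{b,w}$ be the block obtained by concatenating $2^{bw}\nu_b(P_1)$ copies of $P_1$, then $2^{bw}\nu_b(P_2)$ copies of $P_2$, and so on up to $P_{(b+1)^w}$ (multiplicities $(2^b-b)^{g}$, $g$ = number of digits equal to $b$). For a block $B=(c_1,\dots,c_k)$ with digits in $\{0,\dots,b\}$, $g_b(B)=|\{j:c_j=b\}|$. For blocks $B,y$, $N(B,y)$ is the number of positions at which $B$ occurs as a contiguous subblock of $y$ (occurrences may overlap). -}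

module Defs where

open import Data.Nat using (ℕ; zero; suc; _+_; _*_; _∸_; _^_)
open import Data.Fin using (Fin; toℕ; fromℕ)
import Data.Fin as Fin
open import Data.List using (List; []; _∷_; map; concatMap; concat; replicate; length; take; allFin)
open import Data.Bool using (Bool; true; false; if_then_else_; _∧_)
open import Relation.Nullary using (yes; no)
open import Relation.Nullary.Decidable using (⌊_⌋)
open import Data.List.Properties using (≡-dec)

Block : ℕ → Set
Block b = List (Fin (suc b))

allBlocks : (b w : ℕ) → List (Block b)
allBlocks b zero    = [] ∷ []
allBlocks b (suc w) = concatMap (λ d → map (d ∷_) (allBlocks b w)) (allFin (suc b))

g : (b : ℕ) → Block b → ℕ
g b []       = 0
g b (c ∷ cs) with c Fin.≟ fromℕ b
... | yes _ = suc (g b cs)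
... | no  _ = g b cs

-- 2^{bw} ν_b(P) = (2^b - b)^{g_b(P)}  (2^b ≥ b+1, so ∸ is exact subtraction)
mult : (b : ℕ) → Block b → ℕ
mult b P = (2 ^ b ∸ b) ^ g b P

Pbw : (b w : ℕ) → Block b
Pbw b w = concatMap (λ P → concat (replicate (mult b P) P)) (allBlocks b w)

N : {b : ℕ} → Block b → Block b → ℕ
N B [] = 0
N B (c ∷ y) = (if ⌊ ≡-dec Fin._≟_ B (take (length B) (c ∷ y)) ⌋ then 1 else 0) + N B y

module Submission where

-- Every block P of length w occurs mult P times in P_{b,w}, and occurrence counts are
-- superadditive under concatenation, so N(B, P_{b,w}) is at least the weighted count
-- Σ_P mult(P) N(B, P).  The weight mult is a product of digit weights (2^b − b for the
-- digit b, 1 otherwise) which sum to 2^b, so at each of the w − k + 1 positions the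
-- blocks carrying B there have total weight mult(B) 2^{b(w−k)}.  Peeling off the first
-- digit turns this into a recursion on w.

open import Defs
open import Data.Nat using (ℕ; zero; suc; _*_; _∸_; _^_; _≤_; _+_; z≤n)
open import Data.Nat.Properties
open import Data.Nat.ListAction using (sum)
open import Data.Nat.ListAction.Properties using (sum-++)
open import Data.Nat.Solver using (module +-*-Solver)
open import Data.List using (List; []; _∷_; length; map; concat; concatMap; replicate; take; _++_; allFin; tabulate)
open import Data.List.Properties using (≡-dec; map-++; map-∘; map-cong; map-tabulate; tabulate-cong; ∷-injectiveʳ)
open import Data.List.Membership.Propositional using (_∈_)
open import Data.List.Membership.Propositional.Properties using (∈-allFin)
open import Data.List.Relation.Unary.Any using (here; there)
open import Data.Fin using (Fin; fromℕ)
import Data.Fin as Fin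
open import Data.Bool using (if_then_else_)
open import Data.Empty using (⊥-elim)
open import Relation.Nullary using (yes; no)
open import Relation.Nullary.Decidable using (⌊_⌋)
open import Relation.Binary.PropositionalEquality
open import Function using (_∘_; id; case_of_)

sum-map-+ : ∀ {A : Set} (f h : A → ℕ) xs →
  sum (map (λ x → f x + h x) xs) ≡ sum (map f xs) + sum (map h xs)
sum-map-+ f h [] = refl
sum-map-+ f h (x ∷ xs) rewrite sum-map-+ f h xs =
  +-*-Solver.solve 4 (λ a b c d → (a :+ b) :+ (c :+ d) := (a :+ c) :+ (b :+ d)) refl
    (f x) (h x) (sum (map f xs)) (sum (map h xs))
  where open +-*-Solver

sum-map-*ˡ : ∀ {A : Set} (a : ℕ) (f : A → ℕ) xs → sum (map (λ x → a * f x) xs) ≡ a * sum (map f xs)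
sum-map-*ˡ a f [] = sym (*-zeroʳ a)
sum-map-*ˡ a f (x ∷ xs) rewrite sum-map-*ˡ a f xs = sym (*-distribˡ-+ a (f x) (sum (map f xs)))

sum-map-*ʳ : ∀ {A : Set} (a : ℕ) (f : A → ℕ) xs → sum (map (λ x → f x * a) xs) ≡ sum (map f xs) * a
sum-map-*ʳ a f [] = refl
sum-map-*ʳ a f (x ∷ xs) rewrite sum-map-*ʳ a f xs = sym (*-distribʳ-+ a (f x) (sum (map f xs)))

sum-map-mono : ∀ {A : Set} {f h : A → ℕ} → (∀ x → f x ≤ h x) → ∀ xs → sum (map f xs) ≤ sum (map h xs)
sum-map-mono f≤h [] = z≤n
sum-map-mono f≤h (x ∷ xs) = +-mono-≤ (f≤h x) (sum-map-mono f≤h xs)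

∈⇒≤-sum-map : ∀ {A : Set} (f : A → ℕ) {x : A} {xs} → x ∈ xs → f x ≤ sum (map f xs)
∈⇒≤-sum-map f (here refl) = m≤m+n _ _
∈⇒≤-sum-map f {xs = y ∷ ys} (there x∈ys) = ≤-trans (∈⇒≤-sum-map f x∈ys) (m≤n+m _ (f y))

sum-map-concatMap : ∀ {A B : Set} (h : B → ℕ) (k : A → List B) xs →
  sum (map h (concatMap k xs)) ≡ sum (map (λ x → sum (map h (k x))) xs)
sum-map-concatMap h k [] = refl
sum-map-concatMap h k (x ∷ xs) = begin
  sum (map h (k x ++ concatMap k xs))               ≡⟨ cong sum (map-++ h (k x) (concatMap k xs)) ⟩
  sum (map h (k x) ++ map h (concatMap k xs))       ≡⟨ sum-++ (map h (k x)) _ ⟩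
  sum (map h (k x)) + sum (map h (concatMap k xs))  ≡⟨ cong (sum (map h (k x)) +_) (sum-map-concatMap h k xs) ⟩
  sum (map (λ x → sum (map h (k x))) (x ∷ xs))      ∎
  where open ≡-Reasoning

take-++ˡ : ∀ {A : Set} n (xs ys : List A) → length (take n xs) ≡ n → take n (xs ++ ys) ≡ take n xs
take-++ˡ zero xs ys _ = refl
take-++ˡ (suc n) (x ∷ xs) ys eq = cong (x ∷_) (take-++ˡ n xs ys (suc-injective eq))

n≤2^n : ∀ n → n ≤ 2 ^ n
n≤2^n zero = z≤n
n≤2^n (suc n) = +-mono-≤ (m^n>0 2 n) (≤-trans (n≤2^n n) (m≤m+n (2 ^ n) 0))

module _ {b : ℕ} where

  isMatch : Block b → Block b → ℕ
  isMatch B T = if ⌊ ≡-dec Fin._≟_ B T ⌋ then 1 else 0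

  occursAtStart : Block b → Block b → ℕ
  occursAtStart B y = isMatch B (take (length B) y)

  isMatch-≡ : ∀ {B T : Block b} → B ≡ T → isMatch B T ≡ 1
  isMatch-≡ {B} {T} B≡T with ≡-dec Fin._≟_ B T
  ... | yes _   = refl
  ... | no B≢T = ⊥-elim (B≢T B≡T)

  isMatch-≢ : ∀ {B T : Block b} → B ≢ T → isMatch B T ≡ 0
  isMatch-≢ {B} {T} B≢T with ≡-dec Fin._≟_ B T
  ... | yes B≡T = ⊥-elim (B≢T B≡T)
  ... | no _    = refl

  isMatch-∷ : ∀ x (B T : Block b) → isMatch (x ∷ B) (x ∷ T) ≡ isMatch B T
  isMatch-∷ x B T = case ≡-dec Fin._≟_ B T of λ where
    (yes B≡T) → trans (isMatch-≡ (cong (x ∷_) B≡T)) (sym (isMatch-≡ B≡T))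
    (no B≢T)  → trans (isMatch-≢ (B≢T ∘ ∷-injectiveʳ)) (sym (isMatch-≢ B≢T))

  occursAtStart-++ : ∀ (B x y : Block b) → occursAtStart B x ≤ occursAtStart B (x ++ y)
  occursAtStart-++ B x y with ≡-dec Fin._≟_ B (take (length B) x)
  ... | no _        = z≤n
  ... | yes B≡prefix = ≤-reflexive (sym (isMatch-≡ (trans B≡prefix
          (sym (take-++ˡ (length B) x y (sym (cong length B≡prefix)))))))

  N-++ : ∀ (B x y : Block b) → N B x + N B y ≤ N B (x ++ y)
  N-++ B [] y = ≤-refl
  N-++ B (c ∷ x) y = begin
    occursAtStart B (c ∷ x) + N B x + N B y           ≡⟨ +-assoc (occursAtStart B (c ∷ x)) _ _ ⟩
    occursAtStart B (c ∷ x) + (N B x + N B y)         ≤⟨ +-mono-≤ (occursAtStart-++ B (c ∷ x) y) (N-++ B x y) ⟩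
    occursAtStart B (c ∷ x ++ y) + N B (x ++ y)       ∎
    where open ≤-Reasoning

  N-concat-replicate : ∀ (B P : Block b) m → m * N B P ≤ N B (concat (replicate m P))
  N-concat-replicate B P zero = z≤n
  N-concat-replicate B P (suc m) =
    ≤-trans (+-monoʳ-≤ (N B P) (N-concat-replicate B P m)) (N-++ B P (concat (replicate m P)))

  N-concatMap : ∀ {A : Set} (B : Block b) (k : A → Block b) xs →
    sum (map (N B ∘ k) xs) ≤ N B (concatMap k xs)
  N-concatMap B k [] = z≤n
  N-concatMap B k (x ∷ xs) =
    ≤-trans (+-monoʳ-≤ (N B (k x)) (N-concatMap B k xs)) (N-++ B (k x) (concatMap k xs))

topWeight : (n c : ℕ) → Fin (suc n) → ℕ
topWeight n c d with d Fin.≟ fromℕ n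
... | yes _ = c
... | no _  = 1

topWeight-suc : ∀ n c d → topWeight (suc n) c (Fin.suc d) ≡ topWeight n c d
topWeight-suc n c d with d Fin.≟ fromℕ n
... | yes _ = refl
... | no _  = refl

sum-topWeight : ∀ n c → sum (map (topWeight n c) (allFin (suc n))) ≡ n + c
sum-topWeight n c = trans (cong sum (map-tabulate id (topWeight n c))) (sum-tabulate n)
  where
  sum-tabulate : ∀ n → sum (tabulate (topWeight n c)) ≡ n + c
  sum-tabulate zero = +-identityʳ c
  sum-tabulate (suc n) =
    cong suc (trans (cong sum (tabulate-cong (topWeight-suc n c))) (sum-tabulate n))

module _ (b : ℕ) where

  digitWeight : Fin (suc b) → ℕ
  digitWeight = topWeight b (2 ^ b ∸ b)

  mult-∷ : ∀ d P → mult b (d ∷ P) ≡ digitWeight d * mult b P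
  mult-∷ d P with d Fin.≟ fromℕ b
  ... | yes _ = refl
  ... | no _  = sym (+-identityʳ _)

  sum-digitWeight-* : ∀ c → sum (map (λ d → digitWeight d * c) (allFin (suc b))) ≡ 2 ^ b * c
  sum-digitWeight-* c = begin
    sum (map (λ d → digitWeight d * c) (allFin (suc b)))  ≡⟨ sum-map-*ʳ c digitWeight (allFin (suc b)) ⟩
    sum (map digitWeight (allFin (suc b))) * c            ≡⟨ cong (_* c) (sum-topWeight b (2 ^ b ∸ b)) ⟩
    (b + (2 ^ b ∸ b)) * c                                 ≡⟨ cong (_* c) (m+[n∸m]≡n (n≤2^n b)) ⟩
    2 ^ b * c                                             ∎
    where open ≡-Reasoning

  weightedSum : (Block b → ℕ) → ℕ → ℕ
  weightedSum f w = sum (map (λ P → mult b P * f P) (allBlocks b w))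

  weightedSum-suc : ∀ f w → weightedSum f (suc w)
    ≡ sum (map (λ d → digitWeight d * weightedSum (f ∘ (d ∷_)) w) (allFin (suc b)))
  weightedSum-suc f w =
    trans (sum-map-concatMap term (λ d → map (d ∷_) (allBlocks b w)) (allFin (suc b)))
      (cong sum (map-cong peel (allFin (suc b))))
    where
    term : Block b → ℕ
    term P = mult b P * f P
    peel : ∀ d → sum (map term (map (d ∷_) (allBlocks b w)))
                 ≡ digitWeight d * weightedSum (f ∘ (d ∷_)) w
    peel d = begin
      sum (map term (map (d ∷_) (allBlocks b w)))
        ≡⟨ cong sum (sym (map-∘ (allBlocks b w))) ⟩
      sum (map (λ P → mult b (d ∷ P) * f (d ∷ P)) (allBlocks b w))
        ≡⟨ cong sum (map-cong (λ P → trans (cong (_* f (d ∷ P)) (mult-∷ d P)) (*-assoc (digitWeight d) _ _)) (allBlocks b w)) ⟩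
      sum (map (λ P → digitWeight d * (mult b P * f (d ∷ P))) (allBlocks b w))
        ≡⟨ sum-map-*ˡ (digitWeight d) _ (allBlocks b w) ⟩
      digitWeight d * weightedSum (f ∘ (d ∷_)) w ∎
      where open ≡-Reasoning

  weightedSum-+ : ∀ f h w → weightedSum (λ P → f P + h P) w ≡ weightedSum f w + weightedSum h w
  weightedSum-+ f h w =
    trans (cong sum (map-cong (λ P → *-distribˡ-+ (mult b P) (f P) (h P)) (allBlocks b w)))
      (sum-map-+ _ _ (allBlocks b w))

  weightedSum-1 : ∀ w → weightedSum (λ _ → 1) w ≡ 2 ^ (b * w)
  weightedSum-1 zero = cong (2 ^_) (sym (*-zeroʳ b))
  weightedSum-1 (suc w) = begin
    weightedSum (λ _ → 1) (suc w)
      ≡⟨ weightedSum-suc (λ _ → 1) w ⟩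
    sum (map (λ d → digitWeight d * weightedSum (λ _ → 1) w) (allFin (suc b)))
      ≡⟨ sum-digitWeight-* (weightedSum (λ _ → 1) w) ⟩
    2 ^ b * weightedSum (λ _ → 1) w
      ≡⟨ cong (2 ^ b *_) (weightedSum-1 w) ⟩
    2 ^ b * 2 ^ (b * w)
      ≡⟨ sym (^-distribˡ-+-* 2 b (b * w)) ⟩
    2 ^ (b + b * w)
      ≡⟨ cong (2 ^_) (sym (*-suc b w)) ⟩
    2 ^ (b * suc w) ∎
    where open ≡-Reasoning

  -- Only the first digit x is kept; the other first digits contribute 0, so this is in fact an equality.
  weightedSum-occursAtStart : ∀ (B : Block b) d →
    mult b B * 2 ^ (b * d) ≤ weightedSum (occursAtStart B) (length B + d)
  weightedSum-occursAtStart [] d = ≤-reflexive (trans (+-identityʳ _) (sym (weightedSum-1 d)))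
  weightedSum-occursAtStart (x ∷ B) d = begin
    mult b (x ∷ B) * 2 ^ (b * d)
      ≡⟨ trans (cong (_* 2 ^ (b * d)) (mult-∷ x B)) (*-assoc (digitWeight x) _ _) ⟩
    digitWeight x * (mult b B * 2 ^ (b * d))
      ≤⟨ *-monoʳ-≤ (digitWeight x) (weightedSum-occursAtStart B d) ⟩
    digitWeight x * weightedSum (occursAtStart B) (length B + d)
      ≡⟨ cong (λ s → digitWeight x * sum s)
           (map-cong (λ Q → cong (mult b Q *_) (sym (isMatch-∷ x B (take (length B) Q)))) (allBlocks b (length B + d))) ⟩
    term x
      ≤⟨ ∈⇒≤-sum-map term (∈-allFin x) ⟩
    sum (map term (allFin (suc b)))
      ≡⟨ sym (weightedSum-suc (occursAtStart (x ∷ B)) (length B + d)) ⟩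
    weightedSum (occursAtStart (x ∷ B)) (length (x ∷ B) + d) ∎
    where
    open ≤-Reasoning
    term : Fin (suc b) → ℕ
    term d′ = digitWeight d′ * weightedSum (occursAtStart (x ∷ B) ∘ (d′ ∷_)) (length B + d)

  weightedSum-N-suc : ∀ (B : Block b) w →
    weightedSum (N B) (suc w) ≡ weightedSum (occursAtStart B) (suc w) + 2 ^ b * weightedSum (N B) w
  weightedSum-N-suc B w = begin
    weightedSum (N B) (suc w)
      ≡⟨ weightedSum-suc (N B) w ⟩
    sum (map (λ d → digitWeight d * weightedSum (N B ∘ (d ∷_)) w) digits)
      ≡⟨ cong sum (map-cong (λ d → cong (digitWeight d *_) (weightedSum-+ (occursAtStart B ∘ (d ∷_)) (N B) w)) digits) ⟩
    sum (map (λ d → digitWeight d * (atStart d + weightedSum (N B) w)) digits)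
      ≡⟨ cong sum (map-cong (λ d → *-distribˡ-+ (digitWeight d) (atStart d) _) digits) ⟩
    sum (map (λ d → digitWeight d * atStart d + digitWeight d * weightedSum (N B) w) digits)
      ≡⟨ sum-map-+ (λ d → digitWeight d * atStart d) (λ d → digitWeight d * weightedSum (N B) w) digits ⟩
    sum (map (λ d → digitWeight d * atStart d) digits) + sum (map (λ d → digitWeight d * weightedSum (N B) w) digits)
      ≡⟨ cong₂ _+_ (sym (weightedSum-suc (occursAtStart B) w)) (sum-digitWeight-* (weightedSum (N B) w)) ⟩
    weightedSum (occursAtStart B) (suc w) + 2 ^ b * weightedSum (N B) w ∎
    where
    open ≡-Reasoning
    digits = allFin (suc b)
    atStart : Fin (suc b) → ℕ
    atStart d = weightedSum (occursAtStart B ∘ (d ∷_)) w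

  weightedSum-N : ∀ x (B : Block b) d → let C = x ∷ B in
    (d + 1) * mult b C * 2 ^ (b * d) ≤ weightedSum (N C) (length C + d)
  weightedSum-N x B zero = begin
    (0 + 1) * mult b C * 2 ^ (b * 0)           ≡⟨ cong (_* 2 ^ (b * 0)) (*-identityˡ (mult b C)) ⟩
    mult b C * 2 ^ (b * 0)                      ≤⟨ weightedSum-occursAtStart C 0 ⟩
    weightedSum (occursAtStart C) (length C + 0) ≤⟨ m≤m+n _ _ ⟩
    weightedSum (occursAtStart C) (length C + 0) + 2 ^ b * weightedSum (N C) (length B + 0)
                                                 ≡⟨ sym (weightedSum-N-suc C (length B + 0)) ⟩
    weightedSum (N C) (length C + 0)            ∎
    where
    open ≤-Reasoning
    C = x ∷ B
  weightedSum-N x B (suc d) = begin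
    (suc d + 1) * X * 2 ^ (b * suc d)
      ≡⟨ cong ((suc d + 1) * X *_) 2^[b*suc-d] ⟩
    (suc d + 1) * X * (2 ^ b * 2 ^ (b * d))
      ≡⟨ +-*-Solver.solve 4 (λ d X T Y → (con 1 :+ d :+ con 1) :* X :* (T :* Y) := X :* (T :* Y) :+ T :* ((d :+ con 1) :* X :* Y))
           refl d X (2 ^ b) (2 ^ (b * d)) ⟩
    X * (2 ^ b * 2 ^ (b * d)) + 2 ^ b * ((d + 1) * X * 2 ^ (b * d))
      ≡⟨ cong (λ t → X * t + 2 ^ b * ((d + 1) * X * 2 ^ (b * d))) (sym 2^[b*suc-d]) ⟩
    X * 2 ^ (b * suc d) + 2 ^ b * ((d + 1) * X * 2 ^ (b * d))
      ≤⟨ +-mono-≤ (weightedSum-occursAtStart C (suc d)) (*-monoʳ-≤ (2 ^ b) (weightedSum-N x B d)) ⟩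
    weightedSum (occursAtStart C) (length C + suc d) + 2 ^ b * weightedSum (N C) (length C + d)
      ≡⟨ cong (λ w → weightedSum (occursAtStart C) w + 2 ^ b * weightedSum (N C) (length C + d)) (+-suc (length C) d) ⟩
    weightedSum (occursAtStart C) (suc (length C + d)) + 2 ^ b * weightedSum (N C) (length C + d)
      ≡⟨ sym (weightedSum-N-suc C (length C + d)) ⟩
    weightedSum (N C) (suc (length C + d))
      ≡⟨ cong (weightedSum (N C)) (sym (+-suc (length C) d)) ⟩
    weightedSum (N C) (length C + suc d) ∎
    where
    open ≤-Reasoning
    open +-*-Solver
    C = x ∷ B
    X = mult b C
    2^[b*suc-d] : 2 ^ (b * suc d) ≡ 2 ^ b * 2 ^ (b * d)
    2^[b*suc-d] = trans (cong (2 ^_) (*-suc b d)) (^-distribˡ-+-* 2 b (b * d))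

  weightedSum-N≤N-Pbw : ∀ (B : Block b) w → weightedSum (N B) w ≤ N B (Pbw b w)
  weightedSum-N≤N-Pbw B w = ≤-trans
    (sum-map-mono (λ P → N-concat-replicate B P (mult b P)) (allBlocks b w))
    (N-concatMap B (λ P → concat (replicate (mult b P) P)) (allBlocks b w))

lemma3 : (w k b : ℕ) → 1 ≤ w → 1 ≤ k → 1 ≤ b → k ≤ w →
    (B : Block b) → length B ≡ k →
    (w ∸ k + 1) * ((2 ^ b ∸ b) ^ g b B) * 2 ^ (b * (w ∸ k)) ≤ N B (Pbw b w)
lemma3 w .0 b _ () _ _ [] refl
lemma3 w .(length (x ∷ B)) b _ _ _ k≤w (x ∷ B) refl = begin
  (w ∸ k + 1) * mult b (x ∷ B) * 2 ^ (b * (w ∸ k))  ≤⟨ weightedSum-N b x B (w ∸ k) ⟩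
  weightedSum b (N (x ∷ B)) (k + (w ∸ k))           ≡⟨ cong (weightedSum b (N (x ∷ B))) (m+[n∸m]≡n k≤w) ⟩
  weightedSum b (N (x ∷ B)) w                       ≤⟨ weightedSum-N≤N-Pbw b (x ∷ B) w ⟩
  N (x ∷ B) (Pbw b w)                               ∎
  where
  open ≤-Reasoning
  k = length (x ∷ B)
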